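{- Let $C$ be a cycle of length five or six. If $G$ is obtained from $C$ by adding a path of length two or three between two nonadjacent vertices of $C$, then $G$ is configurable.
   Context: Adding a path $P$ between distinct vertices $x,y$ of a graph $H$ means taking the disjoint union of $H$ and $P$ and identifying one end of $P$ with $x$ and the other end with $y$. $[5]^2$ is the set of $2$-element subsets of $\{1,2,3,4,5\}$. A configuration on a graph $G$ is a map $f:V(G)\to[5]^2$ with $\bigcup_{u\in N[v]} f(u)=\{1,2,3,4,5\}$ for every vertex $v$, where $N[v]$ is the closed neighborhood; $G$ is configurable if it has a configuration. -}

module Defs where

open import Data.Nat using (ℕ; suc; _+_; _∸_)
open import Data.Fin using (Fin; toℕ)
open import Data.Fin.Subset using (Subset; ∣_∣; _∈_)
open import Data.Sum using (_⊎_; inj₁; inj₂)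
open import Data.Product using (Σ; ∃; _×_)
open import Relation.Binary.PropositionalEquality using (_≡_)

record Graph : Set₁ where
  field
    V   : Set
    Adj : V → V → Set
open Graph public

-- [5]^2 : 2-element subsets of {1,...,5} (represented as Fin 5).
Pair5 : Set
Pair5 = Σ (Subset 5) (λ s → ∣ s ∣ ≡ 2)

IsConfiguration : (G : Graph) → (V G → Pair5) → Set
IsConfiguration G f =
  (v : V G) (c : Fin 5) →
    (c ∈ Data.Product.proj₁ (f v)) ⊎ ∃ (λ u → Adj G v u × c ∈ Data.Product.proj₁ (f u))

Configurable : Graph → Set
Configurable G = Σ (V G → Pair5) (IsConfiguration G)

CycSucc : (m : ℕ) → Fin m → Fin m → Set
CycSucc m i j = (toℕ j ≡ suc (toℕ i)) ⊎ (suc (toℕ i) ≡ m × toℕ j ≡ 0)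

CycAdj : (m : ℕ) → Fin m → Fin m → Set
CycAdj m i j = CycSucc m i j ⊎ CycSucc m j i

data PathEdge (m ℓ : ℕ) (x y : Fin m) : Fin m ⊎ Fin (ℓ ∸ 1) → Fin m ⊎ Fin (ℓ ∸ 1) → Set where
  start : (i : Fin (ℓ ∸ 1)) → toℕ i ≡ 0 → PathEdge m ℓ x y (inj₁ x) (inj₂ i)
  mid   : (i j : Fin (ℓ ∸ 1)) → toℕ j ≡ suc (toℕ i) → PathEdge m ℓ x y (inj₂ i) (inj₂ j)
  end   : (i : Fin (ℓ ∸ 1)) → suc (toℕ i) ≡ ℓ ∸ 1 → PathEdge m ℓ x y (inj₂ i) (inj₁ y)

data CycPlusPathAdj (m ℓ : ℕ) (x y : Fin m) : Fin m ⊎ Fin (ℓ ∸ 1) → Fin m ⊎ Fin (ℓ ∸ 1) → Set where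
  cyc : (i j : Fin m) → CycAdj m i j → CycPlusPathAdj m ℓ x y (inj₁ i) (inj₁ j)
  fwd : ∀ u v → PathEdge m ℓ x y u v → CycPlusPathAdj m ℓ x y u v
  bwd : ∀ u v → PathEdge m ℓ x y v u → CycPlusPathAdj m ℓ x y u v

CycPlusPath : (m ℓ : ℕ) → Fin m → Fin m → Graph
CycPlusPath m ℓ x y = record { V = Fin m ⊎ Fin (ℓ ∸ 1) ; Adj = CycPlusPathAdj m ℓ x y }

-- C₅ and C₆ have configurations f (01,23,04,12,34 and 01,23,04,12,03,24 around the
-- cycle) in which any two non-adjacent vertices carry different labels sharing a
-- colour. Cycle vertices stay covered when a path x … y is added, so only the new
-- vertices need labels: on x–w–y, w gets the at most two colours missing from
-- f x ∪ f y; on x–a–b–y, a and b split the four colours other than some c ∈ f x ∩ f y.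
module Submission where

open import Defs
open import Data.Nat using (ℕ; suc; _∸_; _≟_)
open import Data.Fin using (Fin; toℕ; #_) renaming (zero to fzero; suc to fsuc)
import Data.Fin.Properties as Fin
open import Data.Fin.Subset using (Subset; _∈_; ∣_∣; ⁅_⁆; _∪_)
open import Data.Fin.Subset.Properties using (_∈?_; anySubset?)
open import Data.Product using (∃; ∃₂; _×_; _,_; proj₁; proj₂)
open import Data.Sum using (_⊎_; inj₁; inj₂; [_,_])
import Data.Sum as Sum
open import Data.Vec using (_∷_; []; lookup)
open import Relation.Binary using (Decidable)
open import Relation.Binary.PropositionalEquality using (_≡_; refl)
open import Relation.Nullary using (¬_; Dec; _⊎-dec_; _×-dec_; _→-dec_; ¬?)
open import Relation.Nullary.Decidable using (True; toWitness; from-yes; map′)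

colours : Pair5 → Subset 5
colours = proj₁

pair : (i j : Fin 5) {_ : True (∣ ⁅ i ⁆ ∪ ⁅ j ⁆ ∣ ≟ 2)} → Pair5
pair i j {two} = ⁅ i ⁆ ∪ ⁅ j ⁆ , toWitness two

Covers : ∀ {n} → Subset n → Subset n → Subset n → Set
Covers p q r = ∀ c → c ∈ p ⊎ c ∈ q ⊎ c ∈ r

covers? : ∀ {n} (p q r : Subset n) → Dec (Covers p q r)
covers? p q r = Fin.all? λ c → (c ∈? p) ⊎-dec (c ∈? q) ⊎-dec (c ∈? r)

Covered : (G : Graph) → (V G → Pair5) → V G → Fin 5 → Set
Covered G f v c = c ∈ colours (f v) ⊎ ∃ λ u → Adj G v u × c ∈ colours (f u)

covered-by-neighbours : (G : Graph) (f : V G → Pair5) {v u u′ : V G} →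
  Adj G v u → Adj G v u′ →
  Covers (colours (f v)) (colours (f u)) (colours (f u′)) →
  ∀ c → Covered G f v c
covered-by-neighbours G f v~u v~u′ cover c =
  Sum.map₂ [ (λ c∈u → _ , v~u , c∈u) , (λ c∈u′ → _ , v~u′ , c∈u′) ] (cover c)

Cycle : ℕ → Graph
Cycle m = record { V = Fin m ; Adj = CycAdj m }

cycSucc? : ∀ m → Decidable (CycSucc m)
cycSucc? m i j = (toℕ j ≟ suc (toℕ i)) ⊎-dec ((suc (toℕ i) ≟ m) ×-dec (toℕ j ≟ 0))

cycAdj? : ∀ m → Decidable (CycAdj m)
cycAdj? m i j = cycSucc? m i j ⊎-dec cycSucc? m j i

cycleConfiguration? : ∀ m (f : Fin m → Pair5) → Dec (IsConfiguration (Cycle m) f)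
cycleConfiguration? m f = Fin.all? λ v → Fin.all? λ c →
  (c ∈? colours (f v)) ⊎-dec Fin.any? λ u → cycAdj? m v u ×-dec (c ∈? colours (f u))

Bridgeable₂ : Subset 5 → Subset 5 → Set
Bridgeable₂ p q = ∃ λ (w : Pair5) → Covers (colours w) p q

bridgeable₂? : ∀ p q → Dec (Bridgeable₂ p q)
bridgeable₂? p q =
  map′ (λ (w , ∣w∣≡2 , cover) → (w , ∣w∣≡2) , cover)
       (λ ((w , ∣w∣≡2) , cover) → w , ∣w∣≡2 , cover)
       (anySubset? λ w → (∣ w ∣ ≟ 2) ×-dec covers? w p q)

Bridgeable₃ : Subset 5 → Subset 5 → Set
Bridgeable₃ p q = ∃₂ λ (a b : Pair5) →
  Covers (colours a) p (colours b) × Covers (colours b) (colours a) q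

Meet : ∀ {n} → Subset n → Subset n → Set
Meet p q = ∃ λ c → c ∈ p × c ∈ q

meet? : ∀ {n} (p q : Subset n) → Dec (Meet p q)
meet? p q = Fin.any? λ c → (c ∈? p) ×-dec (c ∈? q)

splitOff : Fin 5 → Pair5 × Pair5
splitOff fzero = pair (# 1) (# 2) , pair (# 3) (# 4)
splitOff (fsuc fzero) = pair (# 0) (# 2) , pair (# 3) (# 4)
splitOff (fsuc (fsuc fzero)) = pair (# 0) (# 1) , pair (# 3) (# 4)
splitOff (fsuc (fsuc (fsuc fzero))) = pair (# 0) (# 1) , pair (# 2) (# 4)
splitOff (fsuc (fsuc (fsuc (fsuc fzero)))) = pair (# 0) (# 1) , pair (# 2) (# 3)

splitOff-covers : ∀ c d →
  d ≡ c ⊎ d ∈ colours (proj₁ (splitOff c)) ⊎ d ∈ colours (proj₂ (splitOff c))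
splitOff-covers = from-yes (Fin.all? λ c → Fin.all? λ d →
  (d Fin.≟ c) ⊎-dec (d ∈? colours (proj₁ (splitOff c))) ⊎-dec (d ∈? colours (proj₂ (splitOff c))))

meet⇒bridgeable₃ : ∀ {p q} → Meet p q → Bridgeable₃ p q
meet⇒bridgeable₃ {p} {q} (c , c∈p , c∈q) = a , b , cover-a , cover-b
  where
  a = proj₁ (splitOff c)
  b = proj₂ (splitOff c)

  cover-a : Covers (colours a) p (colours b)
  cover-a d with splitOff-covers c d
  ... | inj₁ refl         = inj₂ (inj₁ c∈p)
  ... | inj₂ (inj₁ d∈a)   = inj₁ d∈a
  ... | inj₂ (inj₂ d∈b)   = inj₂ (inj₂ d∈b)

  cover-b : Covers (colours b) (colours a) q
  cover-b d with splitOff-covers c d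
  ... | inj₁ refl         = inj₂ (inj₂ c∈q)
  ... | inj₂ (inj₁ d∈a)   = inj₂ (inj₁ d∈a)
  ... | inj₂ (inj₂ d∈b)   = inj₁ d∈b

module _ {m : ℕ} (f : Fin m → Pair5) (f-conf : IsConfiguration (Cycle m) f) where

  cycle-vertex-covered : ∀ {ℓ x y} (g : Fin (ℓ ∸ 1) → Pair5) i c →
    Covered (CycPlusPath m ℓ x y) [ f , g ] (inj₁ i) c
  cycle-vertex-covered g i c =
    Sum.map₂ (λ (u , i~u , c∈u) → inj₁ u , cyc i u i~u , c∈u) (f-conf i c)

  add-path₂ : ∀ x y → Bridgeable₂ (colours (f x)) (colours (f y)) →
    Configurable (CycPlusPath m 2 x y)
  add-path₂ x y (w , cover) = h , λ where
      (inj₁ i)     → cycle-vertex-covered g i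
      (inj₂ fzero) → covered-by-neighbours G h
                       (bwd _ _ (start fzero refl)) (fwd _ _ (end fzero refl)) cover
    where
    G = CycPlusPath m 2 x y
    g : Fin 1 → Pair5
    g _ = w
    h = [ f , g ]

  add-path₃ : ∀ x y → Bridgeable₃ (colours (f x)) (colours (f y)) →
    Configurable (CycPlusPath m 3 x y)
  add-path₃ x y (a , b , cover-a , cover-b) = h , λ where
      (inj₁ i)            → cycle-vertex-covered g i
      (inj₂ fzero)        → covered-by-neighbours G h
                              (bwd _ _ (start fzero refl)) (fwd _ _ (mid fzero (fsuc fzero) refl)) cover-a
      (inj₂ (fsuc fzero)) → covered-by-neighbours G h
                              (bwd _ _ (mid fzero (fsuc fzero) refl)) (fwd _ _ (end (fsuc fzero) refl)) cover-b
    where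
    G = CycPlusPath m 3 x y
    g : Fin 2 → Pair5
    g = lookup (a ∷ b ∷ [])
    h = [ f , g ]

NonadjacentBridgeable : ∀ m → (Fin m → Pair5) → Set
NonadjacentBridgeable m f = ∀ x y → ¬ (x ≡ y) → ¬ CycAdj m x y →
  Bridgeable₂ (colours (f x)) (colours (f y)) × Meet (colours (f x)) (colours (f y))

nonadjacentBridgeable? : ∀ m f → Dec (NonadjacentBridgeable m f)
nonadjacentBridgeable? m f = Fin.all? λ x → Fin.all? λ y →
  ¬? (x Fin.≟ y) →-dec ¬? (cycAdj? m x y) →-dec
    (bridgeable₂? (colours (f x)) (colours (f y)) ×-dec meet? (colours (f x)) (colours (f y)))

GoodLabelling : ∀ m → (Fin m → Pair5) → Set
GoodLabelling m f = IsConfiguration (Cycle m) f × NonadjacentBridgeable m f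

pentagon : Fin 5 → Pair5
pentagon = lookup (pair (# 0) (# 1) ∷ pair (# 2) (# 3) ∷ pair (# 0) (# 4) ∷ pair (# 1) (# 2) ∷
                   pair (# 3) (# 4) ∷ [])

hexagon : Fin 6 → Pair5
hexagon = lookup (pair (# 0) (# 1) ∷ pair (# 2) (# 3) ∷ pair (# 0) (# 4) ∷ pair (# 1) (# 2) ∷
                  pair (# 0) (# 3) ∷ pair (# 2) (# 4) ∷ [])

good-labelling : ∀ {m} → m ≡ 5 ⊎ m ≡ 6 → ∃ (GoodLabelling m)
good-labelling (inj₁ refl) =
  pentagon , from-yes (cycleConfiguration? 5 pentagon) , from-yes (nonadjacentBridgeable? 5 pentagon)
good-labelling (inj₂ refl) =
  hexagon , from-yes (cycleConfiguration? 6 hexagon) , from-yes (nonadjacentBridgeable? 6 hexagon)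

lemma2p6 : (m ℓ : ℕ) → (m ≡ 5 ⊎ m ≡ 6) → (ℓ ≡ 2 ⊎ ℓ ≡ 3) →
    (x y : Fin m) → ¬ (x ≡ y) → ¬ CycAdj m x y →
    Configurable (CycPlusPath m ℓ x y)
lemma2p6 m ℓ m∈ ℓ∈ x y x≢y x≁y with good-labelling m∈
... | f , f-conf , bridgeable with bridgeable x y x≢y x≁y | ℓ∈
... | bridge , _    | inj₁ refl = add-path₂ f f-conf x y bridge
... | _      , meet | inj₂ refl = add-path₃ f f-conf x y (meet⇒bridgeable₃ meet)
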